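{- Let $N$ and $d \geqslant 2$ be integers with $d \mid N$, and let $A \subseteq \mathbb{Z}_N$ be $\{x,(d-1)x\}$-free. Then $k = \gcd(d-1,N) \leqslant d-1$, and $$|A| \leqslant \frac{k}{k+1}N \leqslant \frac{d-1}{d}N.$$
   Context: A set $A \subseteq \mathbb{Z}_N$ is $\{x,(d-1)x\}$-free if there is no $x \in \mathbb{Z}_N$ with both $x \in A$ and $(d-1)x \in A$ (multiplication taken modulo $N$). -}

module Defs where

open import Data.Nat using (ℕ; suc; _*_; _∸_; NonZero)
open import Data.Nat.DivMod using (_%_)
open import Data.Fin using (Fin; toℕ; fromℕ<)
open import Data.Fin.Subset using (Subset; _∈_)
open import Data.Product using (_×_)
open import Data.Nat.DivMod using (m%n<n)
open import Relation.Nullary using (¬_)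

scale : ∀ {N} .{{_ : NonZero N}} → ℕ → Fin N → Fin N
scale {N} c x = fromℕ< (m%n<n (c * toℕ x) N)

Free : ∀ {N} .{{_ : NonZero N}} → ℕ → Subset N → Set
Free {N} c A = ∀ (x : Fin N) → ¬ (x ∈ A × scale c x ∈ A)

{-# OPTIONS --safe #-}
-- Let c = d - 1, k = gcd c N and m = N / k. Multiplication by c is k-to-one on ℤ_N:
-- if c a ≡ c b (mod N) then a ≡ b (mod m), so x ↦ (c x, ⌊x / m⌋) is injective. For a
-- {x, c x}-free set A this maps A into (ℤ_N ∖ A) × {0, …, k - 1}, whence |A| ≤ k (N - |A|).
module Submission where

open import Defs
open import Data.Nat using (ℕ; suc; _+_; _*_; _∸_; _≤_; _<_; NonZero; s≤s; z≤n; ≢-nonZero; >-nonZero; ≢-nonZero⁻¹)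
open import Data.Nat.Properties hiding (suc-injective)
open import Data.Nat.Divisibility using (_∣_; divides; *-cancelˡ-∣; ∣⇒≤)
open import Data.Nat.DivMod
open import Data.Nat.GCD using (gcd; gcd[m,n]∣m; gcd[m,n]∣n; gcd[m,n]≢0; gcd[m,n]≤n)
open import Data.Nat.Coprimality using (coprime-/gcd; coprime-divisor) renaming (sym to coprime-sym)
open import Data.Nat.Tactic.RingSolver using (solve-∀)
open import Data.Fin using (Fin; toℕ; fromℕ<; combine) renaming (zero to fzero; suc to fsuc)
open import Data.Fin.Properties using (suc-injective; fromℕ<-injective; toℕ-injective; toℕ<n; combine-injective; injective⇒≤)
open import Data.Fin.Subset using (Subset; ∣_∣; _∈_; ∁; inside; outside)
open import Data.Fin.Subset.Properties using (x∉p⇒x∈∁p; ∣∁p∣≡n∸∣p∣; ∣p∣≤n)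
open import Data.Vec using (_∷_; here; there)
open import Data.Product using (_×_; _,_)
open import Data.Sum using (inj₁; inj₂)
open import Relation.Binary.PropositionalEquality

enumerate : ∀ {n} (p : Subset n) → Fin ∣ p ∣ → Fin n
enumerate (inside ∷ p) fzero = fzero
enumerate (inside ∷ p) (fsuc i) = fsuc (enumerate p i)
enumerate (outside ∷ p) i = fsuc (enumerate p i)

enumerate∈ : ∀ {n} (p : Subset n) (i : Fin ∣ p ∣) → enumerate p i ∈ p
enumerate∈ (inside ∷ p) fzero = here
enumerate∈ (inside ∷ p) (fsuc i) = there (enumerate∈ p i)
enumerate∈ (outside ∷ p) i = there (enumerate∈ p i)

enumerate-injective : ∀ {n} (p : Subset n) {i j : Fin ∣ p ∣} → enumerate p i ≡ enumerate p j → i ≡ j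
enumerate-injective (inside ∷ p) {fzero} {fzero} _ = refl
enumerate-injective (inside ∷ p) {fsuc i} {fsuc j} e = cong fsuc (enumerate-injective p (suc-injective e))
enumerate-injective (outside ∷ p) e = enumerate-injective p (suc-injective e)

index : ∀ {n} (p : Subset n) {x : Fin n} → x ∈ p → Fin ∣ p ∣
index (inside ∷ p) here = fzero
index (inside ∷ p) (there x∈p) = fsuc (index p x∈p)
index (outside ∷ p) (there x∈p) = index p x∈p

index-injective : ∀ {n} (p : Subset n) {x y : Fin n} (x∈p : x ∈ p) (y∈p : y ∈ p) →
  index p x∈p ≡ index p y∈p → x ≡ y
index-injective (inside ∷ p) here here _ = refl
index-injective (inside ∷ p) (there x∈p) (there y∈p) e = cong fsuc (index-injective p x∈p y∈p (suc-injective e))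
index-injective (outside ∷ p) (there x∈p) (there y∈p) e = cong fsuc (index-injective p x∈p y∈p e)

∣p∣≤∣q∣*k : ∀ {m n k} (p : Subset m) (q : Subset n) (f : Fin m → Fin n) (g : Fin m → Fin k) →
  (∀ {x} → x ∈ p → f x ∈ q) →
  (∀ {x y} → f x ≡ f y → g x ≡ g y → x ≡ y) →
  ∣ p ∣ ≤ ∣ q ∣ * k
∣p∣≤∣q∣*k p q f g f[p]⊆q f,g-injective = injective⇒≤ {f = code} code-injective
  where
  code : Fin ∣ p ∣ → Fin (∣ q ∣ * _)
  code i = combine (index q (f[p]⊆q (enumerate∈ p i))) (g (enumerate p i))

  code-injective : ∀ {i j} → code i ≡ code j → i ≡ j
  code-injective e with combine-injective _ _ _ _ e
  ... | fi≡fj , gi≡gj =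
    enumerate-injective p (f,g-injective (index-injective q _ _ fi≡fj) gi≡gj)

%≡%⇒∣∸ : ∀ a b n .{{_ : NonZero n}} → a % n ≡ b % n → n ∣ a ∸ b
%≡%⇒∣∸ a b n a≡b = divides (a / n ∸ b / n) (begin
  a ∸ b                                  ≡⟨ cong₂ _∸_ (m≡m%n+[m/n]*n a n) (m≡m%n+[m/n]*n b n) ⟩
  (a % n + a / n * n) ∸ (b % n + b / n * n) ≡⟨ cong (λ r → (a % n + a / n * n) ∸ (r + b / n * n)) a≡b ⟨
  (a % n + a / n * n) ∸ (a % n + b / n * n) ≡⟨ [m+n]∸[m+o]≡n∸o (a % n) _ _ ⟩
  a / n * n ∸ b / n * n                   ≡⟨ *-distribʳ-∸ n (a / n) (b / n) ⟨
  (a / n ∸ b / n) * n                     ∎)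
  where open ≡-Reasoning

∣∸⇒%≡% : ∀ {a b} n .{{_ : NonZero n}} → b ≤ a → n ∣ a ∸ b → a % n ≡ b % n
∣∸⇒%≡% {a} {b} n b≤a (divides t a∸b≡t*n) = begin
  a % n             ≡⟨ cong (_% n) (m+[n∸m]≡n b≤a) ⟨
  (b + (a ∸ b)) % n ≡⟨ cong (λ r → (b + r) % n) a∸b≡t*n ⟩
  (b + t * n) % n   ≡⟨ [m+kn]%n≡m%n b t n ⟩
  b % n             ∎
  where open ≡-Reasoning

%-/-injective : ∀ {a b} n .{{_ : NonZero n}} → a % n ≡ b % n → a / n ≡ b / n → a ≡ b
%-/-injective {a} {b} n a%n≡b%n a/n≡b/n = begin
  a                 ≡⟨ m≡m%n+[m/n]*n a n ⟩
  a % n + a / n * n ≡⟨ cong₂ (λ r q → r + q * n) a%n≡b%n a/n≡b/n ⟩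
  b % n + b / n * n ≡⟨ m≡m%n+[m/n]*n b n ⟨
  b                 ∎
  where open ≡-Reasoning

n∣m*o⇒n/gcd[m,n]∣o : ∀ m n {o} .{{_ : NonZero (gcd m n)}} → n ∣ m * o → n / gcd m n ∣ o
n∣m*o⇒n/gcd[m,n]∣o m n {o} n∣m*o =
  coprime-divisor (coprime-sym (coprime-/gcd m n)) (*-cancelˡ-∣ (gcd m n) g*n′∣g*[m′*o])
  where
  g*n′∣g*[m′*o] : gcd m n * (n / gcd m n) ∣ gcd m n * (m / gcd m n * o)
  g*n′∣g*[m′*o] = subst₂ _∣_
    (sym (m*[n/m]≡n (gcd[m,n]∣n m n)))
    (trans (cong (_* o) (sym (m*[n/m]≡n (gcd[m,n]∣m m n)))) (*-assoc (gcd m n) _ o))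
    n∣m*o

module Scaling (c N : ℕ) .{{_ : NonZero N}} where

  instance
    gcd≢0 : NonZero (gcd c N)
    gcd≢0 = ≢-nonZero (gcd[m,n]≢0 c N (inj₂ (≢-nonZero⁻¹ N)))

    N/gcd≢0 : NonZero (N / gcd c N)
    N/gcd≢0 = >-nonZero (m≥n⇒m/n>0 (gcd[m,n]≤n c N))

  *-cancel-%-≤ : ∀ {a b} → b ≤ a → c * a % N ≡ c * b % N → a % (N / gcd c N) ≡ b % (N / gcd c N)
  *-cancel-%-≤ {a} {b} b≤a ca≡cb = ∣∸⇒%≡% _ b≤a (n∣m*o⇒n/gcd[m,n]∣o c N N∣c[a∸b])
    where
    N∣c[a∸b] : N ∣ c * (a ∸ b)
    N∣c[a∸b] = subst (N ∣_) (sym (*-distribˡ-∸ c a b)) (%≡%⇒∣∸ (c * a) (c * b) N ca≡cb)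

  *-cancel-% : ∀ {a b} → c * a % N ≡ c * b % N → a % (N / gcd c N) ≡ b % (N / gcd c N)
  *-cancel-% {a} {b} ca≡cb with ≤-total b a
  ... | inj₁ b≤a = *-cancel-%-≤ b≤a ca≡cb
  ... | inj₂ a≤b = sym (*-cancel-%-≤ a≤b (sym ca≡cb))

  block : Fin N → Fin (gcd c N)
  block x = fromℕ< (m<n*o⇒m/o<n (subst (toℕ x <_) N≡gcd*[N/gcd] (toℕ<n x)))
    where
    N≡gcd*[N/gcd] : N ≡ gcd c N * (N / gcd c N)
    N≡gcd*[N/gcd] = sym (m*[n/m]≡n (gcd[m,n]∣n c N))

  scale-block-injective : ∀ {x y} → scale c x ≡ scale c y → block x ≡ block y → x ≡ y
  scale-block-injective cx≡cy bx≡by = toℕ-injective (%-/-injective (N / gcd c N)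
    (*-cancel-% (fromℕ<-injective _ _ _ _ cx≡cy))
    (fromℕ<-injective _ _ _ _ bx≡by))

m≤n*k⇒m*[k+1]≤[m+n]*k : ∀ m n k → m ≤ n * k → m * (k + 1) ≤ (m + n) * k
m≤n*k⇒m*[k+1]≤[m+n]*k m n k m≤n*k = begin
  m * (k + 1)   ≡⟨ lhs m k ⟩
  m * k + m     ≤⟨ +-monoʳ-≤ (m * k) m≤n*k ⟩
  m * k + n * k ≡⟨ *-distribʳ-+ k m n ⟨
  (m + n) * k   ∎
  where
  open ≤-Reasoning
  lhs : ∀ m k → m * (k + 1) ≡ m * k + m
  lhs = solve-∀

k≤c⇒k*N*[1+c]≤c*N*[k+1] : ∀ k N c → k ≤ c → k * N * suc c ≤ c * N * (k + 1)
k≤c⇒k*N*[1+c]≤c*N*[k+1] k N c k≤c = begin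
  k * N * suc c     ≡⟨ lhs k N c ⟩
  N * (k + k * c)   ≤⟨ *-monoʳ-≤ N (+-monoˡ-≤ (k * c) k≤c) ⟩
  N * (c + k * c)   ≡⟨ rhs k N c ⟨
  c * N * (k + 1)   ∎
  where
  open ≤-Reasoning
  lhs : ∀ k N c → k * N * suc c ≡ N * (k + k * c)
  lhs = solve-∀
  rhs : ∀ k N c → c * N * (k + 1) ≡ N * (c + k * c)
  rhs = solve-∀

mainTheorem6 : (N d : ℕ) .{{_ : NonZero N}} → 2 ≤ d → d ∣ N →
    (A : Subset N) → Free (d ∸ 1) A →
    gcd (d ∸ 1) N ≤ d ∸ 1
      × ∣ A ∣ * (gcd (d ∸ 1) N + 1) ≤ gcd (d ∸ 1) N * N
      × gcd (d ∸ 1) N * N * d ≤ (d ∸ 1) * N * (gcd (d ∸ 1) N + 1)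
mainTheorem6 N (suc c@(suc _)) (s≤s (s≤s z≤n)) _ A A-free =
  k≤c , ∣A∣*[k+1]≤k*N , k≤c⇒k*N*[1+c]≤c*N*[k+1] k N c k≤c
  where
  open Scaling c N using (block; scale-block-injective)
  k = gcd c N

  k≤c : k ≤ c
  k≤c = ∣⇒≤ (gcd[m,n]∣m c N)

  ∣A∣≤∣∁A∣*k : ∣ A ∣ ≤ ∣ ∁ A ∣ * k
  ∣A∣≤∣∁A∣*k = ∣p∣≤∣q∣*k A (∁ A) (scale c) block
    (λ x∈A → x∉p⇒x∈∁p (λ cx∈A → A-free _ (x∈A , cx∈A)))
    scale-block-injective

  ∣A∣+∣∁A∣≡N : ∣ A ∣ + ∣ ∁ A ∣ ≡ N
  ∣A∣+∣∁A∣≡N = trans (cong (∣ A ∣ +_) (∣∁p∣≡n∸∣p∣ A)) (m+[n∸m]≡n (∣p∣≤n A))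

  ∣A∣*[k+1]≤k*N : ∣ A ∣ * (k + 1) ≤ k * N
  ∣A∣*[k+1]≤k*N = subst (∣ A ∣ * (k + 1) ≤_)
    (trans (cong (_* k) ∣A∣+∣∁A∣≡N) (*-comm N k))
    (m≤n*k⇒m*[k+1]≤[m+n]*k ∣ A ∣ ∣ ∁ A ∣ k ∣A∣≤∣∁A∣*k)
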